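{- Let $\lambda$ be a nonzero real number. For all $n\ge 0$, $$\mathcal{G}_{n,\lambda}(x+1-\lambda)=2n\,(x-\lambda)_{n-1,\lambda}-\mathcal{G}_{n,\lambda}(x-\lambda),$$ where for $n=0$ the term $2n\,(x-\lambda)_{n-1,\lambda}$ is interpreted as $0$.
   Context: The degenerate falling factorial is $(y)_{0,\lambda}=1$ and $(y)_{n,\lambda}=y(y-\lambda)\cdots(y-(n-1)\lambda)$ for $n\ge1$. The degenerate exponential is $e_\lambda^{y}(t)=\sum_{n=0}^{\infty}(y)_{n,\lambda}\frac{t^n}{n!}$, with $e_\lambda(t)=e_\lambda^{1}(t)$. The degenerate Genocchi polynomials $\mathcal{G}_{n,\lambda}(x)$ are defined by $\frac{2t}{e_\lambda(t)+1}e_\lambda^{x}(t)=\sum_{n=0}^{\infty}\mathcal{G}_{n,\lambda}(x)\frac{t^n}{n!}$. -}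

module Defs where

open import Level using (Level)
open import Data.Nat using (ℕ; zero; suc; _∸_)
import Data.Nat as ℕ
open import Data.Nat.Combinatorics using (_C_)
open import Algebra.Bundles using (CommutativeRing)

-- Everything is developed over an arbitrary commutative ring R
-- (the paper works over ℝ, which is not available in agda-stdlib).
module DegGenocchi {c ℓ : Level} (R : CommutativeRing c ℓ) where
  open CommutativeRing R hiding (zero)

  infixl 6 _⊖_
  _⊖_ : Carrier → Carrier → Carrier
  a ⊖ b = a + (- b)

  _·_ : ℕ → Carrier → Carrier
  zero  · a = 0#
  suc n · a = a + (n · a)

  fall : Carrier → Carrier → ℕ → Carrier
  fall lam y zero    = 1#
  fall lam y (suc n) = fall lam y n * (y ⊖ (n · lam))

  -- formal power series, represented by their EGF coefficients:
  -- f represents  Σ f n t^n / n!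
  Series : Set c
  Series = ℕ → Carrier

  sumTo : (ℕ → Carrier) → ℕ → Carrier
  sumTo f zero    = f zero
  sumTo f (suc n) = sumTo f n + f (suc n)

  -- product of exponential generating functions (binomial convolution)
  _⊛_ : Series → Series → Series
  (f ⊛ g) n = sumTo (λ k → (n C k) · (f k * g (n ∸ k))) n

  _⊕_ : Series → Series → Series
  (f ⊕ g) n = f n + g n

  -- degenerate exponential e_λ^y(t) = Σ (y)_{n,λ} t^n/n!
  eλ : Carrier → Carrier → Series
  eλ lam y = fall lam y

  oneS : Series
  oneS zero    = 1#
  oneS (suc n) = 0#

  -- the series 2t  (EGF coefficient 2 at n = 1, since t = t^1/1!)
  twoT : Series
  twoT (suc zero) = 1# + 1#
  twoT _          = 0#

  -- G (as a function of x, giving the EGF coefficients G n = 𝒢_{n,λ}(x))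
  -- is the degenerate Genocchi family:
  --   2t/(e_λ(t)+1) e_λ^x(t) = Σ G_{n,λ}(x) t^n/n!,
  -- stated in the multiplied-out form (e_λ(t)+1)·ΣG = 2t e_λ^x(t)
  -- (e_λ(t)+1 has constant term 2, invertible by hypothesis).
  IsDegGenocchi : Carrier → (Carrier → Series) → Set (c Level.⊔ ℓ)
  IsDegGenocchi lam G =
    ∀ (x : Carrier) (n : ℕ) → ((eλ lam 1# ⊕ oneS) ⊛ G x) n ≈ (twoT ⊛ eλ lam x) n

  twoNFall : Carrier → Carrier → ℕ → Carrier
  twoNFall lam y zero    = 0#
  twoNFall lam y (suc m) = (2 ℕ.* suc m) · fall lam y m

{-# OPTIONS --safe #-}
module Submission where

-- Put H = e_λ(t) + 1.  Since e_λ^{1+y}(t) = e_λ(t) e_λ^y(t) (Vandermonde for the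
-- degenerate falling factorial), 2t e_λ^{1+y}(t) = e_λ(t) · 2t e_λ^y(t), hence
-- H · (G(1+y) + G(y)) = (e_λ(t) + 1) · 2t e_λ^y(t) = H · 2t e_λ^y(t).  The constant
-- term of H is 2, a unit, so H cancels; the coefficients of 2t e_λ^y(t) are
-- 2n (y)_{n-1,λ}.  Take y = x - λ.

open import Defs
open import Level using (Level)
open import Data.Nat using (ℕ)
open import Data.Product using (∃)
open import Relation.Nullary using (¬_)
open import Algebra.Bundles using (CommutativeRing)

open import Data.Nat as ℕ using (zero; suc; _∸_; _≤_; _<_; s≤s; _!)
open import Data.Nat.Properties as ℕ
  using (+-∸-assoc; m+[n∸m]≡n; m∸n≤m; n∸n≡0; n<1+n; m≤n⇒m≤1+n; *-cancelʳ-≡; _!*_!≢0)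
open import Data.Nat.Combinatorics
  using (_C_; nCk≡n!/k![n-k]!; k![n∸k]!∣n!; nCk+nC[k+1]≡[n+1]C[k+1]; nC1≡n; k>n⇒nCk≡0)
open import Data.Nat.DivMod using (m/n*n≡m)
open import Data.Nat.Induction using (<-rec)
open import Data.Product using (_,_)
open import Function using (_∘_)
open import Relation.Binary.PropositionalEquality as ≡ using (_≡_)

nCk*[k![n∸k]!]≡n! : ∀ {n k} → k ≤ n → (n C k) ℕ.* (k ! ℕ.* (n ∸ k) !) ≡ n !
nCk*[k![n∸k]!]≡n! {n} {k} k≤n =
  ≡.trans (≡.cong (ℕ._* (k ! ℕ.* (n ∸ k) !)) (nCk≡n!/k![n-k]! k≤n)) (m/n*n≡m (k![n∸k]!∣n! k≤n))
  where instance _ = k !* (n ∸ k) !≢0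

[1+n]Ck*[1+[n∸k]]≡[1+n]*nCk : ∀ {n k} → k ≤ n → (suc n C k) ℕ.* suc (n ∸ k) ≡ suc n ℕ.* (n C k)
[1+n]Ck*[1+[n∸k]]≡[1+n]*nCk {n} {k} k≤n = *-cancelʳ-≡ _ _ (k ! ℕ.* (n ∸ k) !) (begin
  (suc n C k) ℕ.* suc (n ∸ k) ℕ.* (k ! ℕ.* (n ∸ k) !)   ≡⟨ solve 4 (λ c s a b → c :* s :* (a :* b) := c :* (a :* (s :* b))) ≡.refl
                                                            (suc n C k) (suc (n ∸ k)) (k !) ((n ∸ k) !) ⟩
  (suc n C k) ℕ.* (k ! ℕ.* suc (n ∸ k) !)               ≡⟨ ≡.cong (λ j → (suc n C k) ℕ.* (k ! ℕ.* j !)) (+-∸-assoc 1 k≤n) ⟨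
  (suc n C k) ℕ.* (k ! ℕ.* (suc n ∸ k) !)               ≡⟨ nCk*[k![n∸k]!]≡n! (m≤n⇒m≤1+n k≤n) ⟩
  suc n !                                             ≡⟨ ≡.cong (suc n ℕ.*_) (nCk*[k![n∸k]!]≡n! k≤n) ⟨
  suc n ℕ.* ((n C k) ℕ.* (k ! ℕ.* (n ∸ k) !))           ≡⟨ ℕ.*-assoc (suc n) (n C k) _ ⟨
  suc n ℕ.* (n C k) ℕ.* (k ! ℕ.* (n ∸ k) !)             ∎)
  where
  open ≡.≡-Reasoning
  open import Data.Nat.Solver using (module +-*-Solver)
  open +-*-Solver
  instance _ = k !* (n ∸ k) !≢0

module DegGenocchiProperties {c ℓ : Level} (R : CommutativeRing c ℓ) where
  open CommutativeRing R hiding (zero)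
  open DegGenocchi R
  open import Relation.Binary.Reasoning.Setoid setoid
  open import Algebra.Properties.Semiring.Mult semiring using (_×_; ×-congʳ; ×-homo-+; ×-assocˡ; ×-assoc-*; ×-comm-*)
  open import Algebra.Properties.CommutativeMonoid.Mult +-commutativeMonoid using (×-distrib-+)
  open import Algebra.Properties.CommutativeSemigroup +-commutativeSemigroup using (interchange; x∙yz≈y∙xz)
  open import Algebra.Properties.AbelianGroup +-abelianGroup using (⁻¹-∙-comm)
  open import Algebra.Properties.Group +-group using (∙-cancelʳ)
  open import Algebra.Properties.Monoid *-monoid using (insertˡ)
  open import Algebra.Solver.Ring.NaturalCoefficients.Default commutativeSemiring using (solve; _:*_; _:+_; _:=_)

  infix 4 _≋_
  _≋_ : Series → Series → Set ℓ
  f ≋ g = ∀ n → f n ≈ g n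

  ·≡× : ∀ n a → n · a ≡ n × a
  ·≡× zero    a = ≡.refl
  ·≡× (suc n) a = ≡.cong (a +_) (·≡× n a)

  ·-congʳ : ∀ n {a b} → a ≈ b → n · a ≈ n · b
  ·-congʳ n {a} {b} a≈b = begin
    n · a ≡⟨ ·≡× n a ⟩
    n × a ≈⟨ ×-congʳ n a≈b ⟩
    n × b ≡⟨ ·≡× n b ⟨
    n · b ∎

  ·-zeroʳ : ∀ n → n · 0# ≈ 0#
  ·-zeroʳ zero    = refl
  ·-zeroʳ (suc n) = trans (+-identityˡ _) (·-zeroʳ n)

  ·-homo-+ : ∀ m n a → (m ℕ.+ n) · a ≈ m · a + n · a
  ·-homo-+ m n a = begin
    (m ℕ.+ n) · a ≡⟨ ·≡× (m ℕ.+ n) a ⟩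
    (m ℕ.+ n) × a ≈⟨ ×-homo-+ a m n ⟩
    m × a + n × a ≡⟨ ≡.cong₂ _+_ (·≡× m a) (·≡× n a) ⟨
    m · a + n · a ∎

  ·-distrib-+ : ∀ n a b → n · (a + b) ≈ n · a + n · b
  ·-distrib-+ n a b = begin
    n · (a + b)   ≡⟨ ·≡× n (a + b) ⟩
    n × (a + b)   ≈⟨ ×-distrib-+ a b n ⟩
    n × a + n × b ≡⟨ ≡.cong₂ _+_ (·≡× n a) (·≡× n b) ⟨
    n · a + n · b ∎

  ·-assocˡ : ∀ m n a → m · (n · a) ≈ (m ℕ.* n) · a
  ·-assocˡ m n a = begin
    m · (n · a)   ≡⟨ ≡.trans (≡.cong (m ·_) (·≡× n a)) (·≡× m (n × a)) ⟩
    m × (n × a)   ≈⟨ ×-assocˡ a m n ⟩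
    (m ℕ.* n) × a ≡⟨ ·≡× (m ℕ.* n) a ⟨
    (m ℕ.* n) · a ∎

  ·-comm-* : ∀ n a b → a * (n · b) ≈ n · (a * b)
  ·-comm-* n a b = begin
    a * (n · b) ≡⟨ ≡.cong (a *_) (·≡× n b) ⟩
    a * (n × b) ≈⟨ ×-comm-* n a b ⟩
    n × (a * b) ≡⟨ ·≡× n (a * b) ⟨
    n · (a * b) ∎

  ·-assoc-* : ∀ n a b → (n · a) * b ≈ n · (a * b)
  ·-assoc-* n a b = begin
    (n · a) * b ≡⟨ ≡.cong (_* b) (·≡× n a) ⟩
    (n × a) * b ≈⟨ ×-assoc-* n a b ⟩
    n × (a * b) ≡⟨ ·≡× n (a * b) ⟨
    n · (a * b) ∎

  sumTo-cong : ∀ {f g} n → (∀ k → k ≤ n → f k ≈ g k) → sumTo f n ≈ sumTo g n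
  sumTo-cong zero    f≈g = f≈g 0 ℕ.z≤n
  sumTo-cong (suc n) f≈g = +-cong (sumTo-cong n (λ k k≤n → f≈g k (m≤n⇒m≤1+n k≤n))) (f≈g (suc n) ℕ.≤-refl)

  sumTo-+ : ∀ f g n → sumTo (λ k → f k + g k) n ≈ sumTo f n + sumTo g n
  sumTo-+ f g zero    = refl
  sumTo-+ f g (suc n) = trans (+-congʳ (sumTo-+ f g n)) (interchange _ _ _ _)

  sumTo-· : ∀ m f n → sumTo (λ k → m · f k) n ≈ m · sumTo f n
  sumTo-· m f zero    = refl
  sumTo-· m f (suc n) = trans (+-congʳ (sumTo-· m f n)) (sym (·-distrib-+ m _ _))

  sumTo-*ʳ : ∀ a f n → sumTo (λ k → f k * a) n ≈ sumTo f n * a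
  sumTo-*ʳ a f zero    = refl
  sumTo-*ʳ a f (suc n) = trans (+-congʳ (sumTo-*ʳ a f n)) (sym (distribʳ a _ _))

  sumTo-suc : ∀ f n → sumTo f (suc n) ≈ f 0 + sumTo (f ∘ suc) n
  sumTo-suc f zero    = refl
  sumTo-suc f (suc n) = trans (+-congʳ (sumTo-suc f n)) (+-assoc _ _ _)

  sumTo-init : ∀ f n → f (suc n) ≈ 0# → sumTo f (suc n) ≈ sumTo f n
  sumTo-init f n fₙ₊₁≈0 = trans (+-congˡ fₙ₊₁≈0) (+-identityʳ _)

  sumTo-head : ∀ f n → (∀ k → f (suc k) ≈ 0#) → sumTo f n ≈ f 0
  sumTo-head f zero    f≈0 = refl
  sumTo-head f (suc n) f≈0 = trans (sumTo-init f n (f≈0 n)) (sumTo-head f n f≈0)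

  ⊛-distribˡ-⊕ : ∀ f g h → f ⊛ (g ⊕ h) ≋ (f ⊛ g) ⊕ (f ⊛ h)
  ⊛-distribˡ-⊕ f g h n = trans
    (sumTo-cong n (λ k _ → trans (·-congʳ (n C k) (distribˡ _ _ _)) (·-distrib-+ (n C k) _ _)))
    (sumTo-+ _ _ n)

  ⊛-distribʳ-⊕ : ∀ f g h → (g ⊕ h) ⊛ f ≋ (g ⊛ f) ⊕ (h ⊛ f)
  ⊛-distribʳ-⊕ f g h n = trans
    (sumTo-cong n (λ k _ → trans (·-congʳ (n C k) (distribʳ _ _ _)) (·-distrib-+ (n C k) _ _)))
    (sumTo-+ _ _ n)

  ·-zeroˡ-* : ∀ n a → n · (0# * a) ≈ 0#
  ·-zeroˡ-* n a = trans (·-congʳ n (zeroˡ a)) (·-zeroʳ n)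

  ⊛-identityˡ : ∀ f → oneS ⊛ f ≋ f
  ⊛-identityˡ f n = begin
    (oneS ⊛ f) n       ≈⟨ sumTo-head _ n (λ k → ·-zeroˡ-* (n C suc k) _) ⟩
    1# * f n + 0#      ≈⟨ +-identityʳ _ ⟩
    1# * f n           ≈⟨ *-identityˡ (f n) ⟩
    f n                ∎

  ⊛-suc : ∀ f g n → (f ⊛ g) (suc n) ≈ f 0 * g (suc n) + sumTo (λ k → (suc n C suc k) · (f (suc k) * g (n ∸ k))) n
  ⊛-suc f g n = trans (sumTo-suc _ n) (+-congʳ (+-identityʳ _))

  -- f ∘ suc is the derivative of f in exponential-generating-function coefficients.
  ⊛-leibniz : ∀ f g n → (f ⊛ g) (suc n) ≈ ((f ∘ suc) ⊛ g) n + (f ⊛ (g ∘ suc)) n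
  ⊛-leibniz f g n = begin
    (f ⊛ g) (suc n)                   ≈⟨ sumTo-suc _ n ⟩
    f₀g + sumTo (λ k → (suc n C suc k) · u (suc k) (n ∸ k)) n
      ≈⟨ +-congˡ (trans (sumTo-cong n (λ k _ → pascal k)) (sumTo-+ _ _ n)) ⟩
    f₀g + (((f ∘ suc) ⊛ g) n + S)     ≈⟨ x∙yz≈y∙xz f₀g _ S ⟩
    ((f ∘ suc) ⊛ g) n + (f₀g + S)     ≈⟨ +-congˡ (sym (sumTo-suc _ n)) ⟩
    ((f ∘ suc) ⊛ g) n + sumTo (λ k → (n C k) · u k (suc n ∸ k)) (suc n)
      ≈⟨ +-congˡ (sumTo-init _ n (reflexive (≡.cong (_· u (suc n) (n ∸ n)) (k>n⇒nCk≡0 (n<1+n n))))) ⟩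
    ((f ∘ suc) ⊛ g) n + sumTo (λ k → (n C k) · u k (suc n ∸ k)) n
      ≈⟨ +-congˡ (sumTo-cong n (λ k k≤n → reflexive (≡.cong (λ j → (n C k) · u k j) (+-∸-assoc 1 k≤n)))) ⟩
    ((f ∘ suc) ⊛ g) n + (f ⊛ (g ∘ suc)) n ∎
    where
    u : ℕ → ℕ → Carrier
    u i j = f i * g j
    f₀g S : Carrier
    f₀g = (suc n C 0) · u 0 (suc n)
    S = sumTo (λ k → (n C suc k) · u (suc k) (n ∸ k)) n
    pascal : ∀ k → (suc n C suc k) · u (suc k) (n ∸ k) ≈ (n C k) · u (suc k) (n ∸ k) + (n C suc k) · u (suc k) (n ∸ k)
    pascal k = trans (reflexive (≡.cong (_· u (suc k) (n ∸ k)) (≡.sym (nCk+nC[k+1]≡[n+1]C[k+1] n k))))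
                     (·-homo-+ (n C k) (n C suc k) _)

  -- tTimes a f is the series a t f(t): its n-th EGF coefficient is n a f_{n-1}.
  tTimes : Carrier → Series → Series
  tTimes a f zero    = 0#
  tTimes a f (suc n) = suc n · (f n * a)

  tTimes-congʳ : ∀ a {f g} → f ≋ g → tTimes a f ≋ tTimes a g
  tTimes-congʳ a f≈g zero    = refl
  tTimes-congʳ a f≈g (suc n) = ·-congʳ (suc n) (*-congʳ (f≈g n))

  ⊛-tTimesʳ : ∀ a f g → f ⊛ tTimes a g ≋ tTimes a (f ⊛ g)
  ⊛-tTimesʳ a f g zero    = trans (+-identityʳ _) (zeroʳ (f 0))
  ⊛-tTimesʳ a f g (suc m) = begin
    (f ⊛ tTimes a g) (suc m)                                      ≈⟨ sumTo-init _ m last≈0 ⟩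
    sumTo (λ k → (suc m C k) · (f k * tTimes a g (suc m ∸ k))) m  ≈⟨ sumTo-cong m term ⟩
    sumTo (λ k → suc m · ((m C k) · (f k * g (m ∸ k)) * a)) m     ≈⟨ sumTo-· (suc m) _ m ⟩
    suc m · sumTo (λ k → (m C k) · (f k * g (m ∸ k)) * a) m       ≈⟨ ·-congʳ (suc m) (sumTo-*ʳ a _ m) ⟩
    suc m · ((f ⊛ g) m * a)                                       ∎
    where
    last≈0 : (suc m C suc m) · (f (suc m) * tTimes a g (m ∸ m)) ≈ 0#
    last≈0 = begin
      (suc m C suc m) · (f (suc m) * tTimes a g (m ∸ m)) ≡⟨ ≡.cong (λ j → (suc m C suc m) · (f (suc m) * tTimes a g j)) (n∸n≡0 m) ⟩
      (suc m C suc m) · (f (suc m) * 0#)                 ≈⟨ ·-congʳ (suc m C suc m) (zeroʳ _) ⟩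
      (suc m C suc m) · 0#                               ≈⟨ ·-zeroʳ (suc m C suc m) ⟩
      0#                                                 ∎
    term : ∀ k → k ≤ m → (suc m C k) · (f k * tTimes a g (suc m ∸ k)) ≈ suc m · ((m C k) · (f k * g (m ∸ k)) * a)
    term k k≤m = begin
      (suc m C k) · (f k * tTimes a g (suc m ∸ k))
        ≡⟨ ≡.cong (λ j → (suc m C k) · (f k * tTimes a g j)) (+-∸-assoc 1 k≤m) ⟩
      (suc m C k) · (f k * (suc (m ∸ k) · (g (m ∸ k) * a)))
        ≈⟨ ·-congʳ (suc m C k) (·-comm-* (suc (m ∸ k)) (f k) _) ⟩
      (suc m C k) · (suc (m ∸ k) · (f k * (g (m ∸ k) * a)))
        ≈⟨ ·-assocˡ (suc m C k) (suc (m ∸ k)) _ ⟩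
      ((suc m C k) ℕ.* suc (m ∸ k)) · (f k * (g (m ∸ k) * a))
        ≡⟨ ≡.cong (_· (f k * (g (m ∸ k) * a))) ([1+n]Ck*[1+[n∸k]]≡[1+n]*nCk k≤m) ⟩
      (suc m ℕ.* (m C k)) · (f k * (g (m ∸ k) * a))
        ≈⟨ ·-assocˡ (suc m) (m C k) _ ⟨
      suc m · ((m C k) · (f k * (g (m ∸ k) * a)))
        ≈⟨ ·-congʳ (suc m) (trans (·-congʳ (m C k) (sym (*-assoc _ _ _))) (sym (·-assoc-* (m C k) _ a))) ⟩
      suc m · ((m C k) · (f k * g (m ∸ k)) * a)
        ∎

  twoT-⊛ : ∀ f → twoT ⊛ f ≋ tTimes (1# + 1#) f
  twoT-⊛ f zero    = ·-zeroˡ-* 1 (f 0)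
  twoT-⊛ f (suc m) = begin
    (twoT ⊛ f) (suc m)                                          ≈⟨ ⊛-suc twoT f m ⟩
    0# * f (suc m) + sumTo (λ k → (suc m C suc k) · (twoT (suc k) * f (m ∸ k))) m
      ≈⟨ +-cong (zeroˡ _) (sumTo-head _ m (λ k → ·-zeroˡ-* (suc m C suc (suc k)) _)) ⟩
    0# + (suc m C 1) · ((1# + 1#) * f m)                        ≈⟨ +-identityˡ _ ⟩
    (suc m C 1) · ((1# + 1#) * f m)                             ≡⟨ ≡.cong (_· ((1# + 1#) * f m)) (nC1≡n (suc m)) ⟩
    suc m · ((1# + 1#) * f m)                                   ≈⟨ ·-congʳ (suc m) (*-comm _ _) ⟩
    suc m · (f m * (1# + 1#))                                   ∎

  ⊛-cancelˡ : ∀ {f v} → f 0 * v ≈ 1# → ∀ g g′ → f ⊛ g ≋ f ⊛ g′ → g ≋ g′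
  ⊛-cancelˡ {f} {v} f₀v≈1 g g′ fg≈fg′ = <-rec (λ n → g n ≈ g′ n) step
    where
    cancel-f₀ : ∀ {a b} → f 0 * a ≈ f 0 * b → a ≈ b
    cancel-f₀ {a} {b} f₀a≈f₀b = begin
      a              ≈⟨ insertˡ vf₀≈1 a ⟩
      v * (f 0 * a)  ≈⟨ *-congˡ f₀a≈f₀b ⟩
      v * (f 0 * b)  ≈⟨ insertˡ vf₀≈1 b ⟨
      b              ∎
      where
      vf₀≈1 : v * f 0 ≈ 1#
      vf₀≈1 = trans (*-comm v (f 0)) f₀v≈1
    tail : Series → ℕ → Carrier
    tail h n = sumTo (λ k → (suc n C suc k) · (f (suc k) * h (n ∸ k))) n
    step : ∀ n → (∀ {j} → j < n → g j ≈ g′ j) → g n ≈ g′ n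
    step zero    _  = cancel-f₀ (begin
      f 0 * g 0       ≈⟨ +-identityʳ _ ⟨
      (f ⊛ g) 0       ≈⟨ fg≈fg′ 0 ⟩
      (f ⊛ g′) 0      ≈⟨ +-identityʳ _ ⟩
      f 0 * g′ 0      ∎)
    step (suc n) ih = cancel-f₀ (∙-cancelʳ (tail g n) _ _ (begin
      f 0 * g (suc n) + tail g n    ≈⟨ ⊛-suc f g n ⟨
      (f ⊛ g) (suc n)               ≈⟨ fg≈fg′ (suc n) ⟩
      (f ⊛ g′) (suc n)              ≈⟨ ⊛-suc f g′ n ⟩
      f 0 * g′ (suc n) + tail g′ n  ≈⟨ +-congˡ tail≈ ⟨
      f 0 * g′ (suc n) + tail g n   ∎))
      where
      tail≈ : tail g n ≈ tail g′ n
      tail≈ = sumTo-cong n (λ k _ → ·-congʳ (suc n C suc k) (*-congˡ (ih (s≤s (m∸n≤m n k)))))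

  fall-cong : ∀ lam {a b} → a ≈ b → fall lam a ≋ fall lam b
  fall-cong lam a≈b zero    = refl
  fall-cong lam a≈b (suc n) = *-cong (fall-cong lam a≈b n) (+-congʳ a≈b)

  +-⊖-·-split : ∀ lam a b {n k} → k ≤ n → (a + b) ⊖ (n · lam) ≈ (a ⊖ (k · lam)) + (b ⊖ ((n ∸ k) · lam))
  +-⊖-·-split lam a b {n} {k} k≤n = begin
    (a + b) ⊖ (n · lam)                             ≡⟨ ≡.cong (λ j → (a + b) ⊖ (j · lam)) (m+[n∸m]≡n k≤n) ⟨
    (a + b) ⊖ ((k ℕ.+ (n ∸ k)) · lam)               ≈⟨ +-congˡ (-‿cong (·-homo-+ k (n ∸ k) lam)) ⟩
    (a + b) ⊖ (k · lam + (n ∸ k) · lam)             ≈⟨ +-congˡ (⁻¹-∙-comm (k · lam) ((n ∸ k) · lam)) ⟨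
    (a + b) + (- (k · lam) + - ((n ∸ k) · lam))     ≈⟨ interchange a b _ _ ⟩
    (a ⊖ (k · lam)) + (b ⊖ ((n ∸ k) · lam))         ∎

  eλ-+ : ∀ lam a b → eλ lam (a + b) ≋ eλ lam a ⊛ eλ lam b
  eλ-+ lam a b zero    = sym (trans (+-identityʳ _) (*-identityˡ 1#))
  eλ-+ lam a b (suc n) = begin
    eλ lam (a + b) n * w                                   ≈⟨ *-congʳ (eλ-+ lam a b n) ⟩
    (f ⊛ g) n * w                                          ≈⟨ sumTo-*ʳ w _ n ⟨
    sumTo (λ k → (n C k) · (f k * g (n ∸ k)) * w) n        ≈⟨ sumTo-cong n term ⟩
    sumTo (λ k → (n C k) · (f (suc k) * g (n ∸ k)) + (n C k) · (f k * g (suc (n ∸ k)))) n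
                                                           ≈⟨ sumTo-+ _ _ n ⟩
    ((f ∘ suc) ⊛ g) n + (f ⊛ (g ∘ suc)) n                  ≈⟨ ⊛-leibniz f g n ⟨
    (f ⊛ g) (suc n)                                        ∎
    where
    f g : Series
    f = eλ lam a
    g = eλ lam b
    w : Carrier
    w = (a + b) ⊖ (n · lam)
    distrib-split : ∀ p q u v → (p * q) * (u + v) ≈ p * u * q + p * (q * v)
    distrib-split = solve 4 (λ p q u v → (p :* q) :* (u :+ v) := p :* u :* q :+ p :* (q :* v)) refl
    term : ∀ k → k ≤ n → (n C k) · (f k * g (n ∸ k)) * w ≈ (n C k) · (f (suc k) * g (n ∸ k)) + (n C k) · (f k * g (suc (n ∸ k)))
    term k k≤n = begin
      (n C k) · (f k * g (n ∸ k)) * w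
        ≈⟨ ·-assoc-* (n C k) _ w ⟩
      (n C k) · (f k * g (n ∸ k) * w)
        ≈⟨ ·-congʳ (n C k) (trans (*-congˡ (+-⊖-·-split lam a b k≤n)) (distrib-split _ _ _ _)) ⟩
      (n C k) · (f (suc k) * g (n ∸ k) + f k * g (suc (n ∸ k)))
        ≈⟨ ·-distrib-+ (n C k) _ _ ⟩
      (n C k) · (f (suc k) * g (n ∸ k)) + (n C k) · (f k * g (suc (n ∸ k)))
        ∎

  twoNFall≋tTimes : ∀ lam y → twoNFall lam y ≋ tTimes (1# + 1#) (fall lam y)
  twoNFall≋tTimes lam y zero    = refl
  twoNFall≋tTimes lam y (suc m) = begin
    (2 ℕ.* suc m) · a   ≡⟨ ≡.cong (_· a) (ℕ.*-comm 2 (suc m)) ⟩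
    (suc m ℕ.* 2) · a   ≈⟨ ·-assocˡ (suc m) 2 a ⟨
    suc m · (2 · a)     ≈⟨ ·-congʳ (suc m) 2·a≈a*2 ⟩
    suc m · (a * (1# + 1#)) ∎
    where
    a : Carrier
    a = fall lam y m
    2·a≈a*2 : 2 · a ≈ a * (1# + 1#)
    2·a≈a*2 = begin
      a + (a + 0#)        ≈⟨ +-congˡ (+-identityʳ a) ⟩
      a + a               ≈⟨ +-cong (*-identityʳ a) (*-identityʳ a) ⟨
      a * 1# + a * 1#     ≈⟨ distribˡ a 1# 1# ⟨
      a * (1# + 1#)       ∎

  genocchi-shift : ∀ {v} → (1# + 1#) * v ≈ 1# → ∀ lam G → IsDegGenocchi lam G →
                   ∀ {x y} → x ≈ 1# + y → G x ⊕ G y ≋ twoNFall lam y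
  genocchi-shift 2v≈1 lam G isG {x} {y} x≈1+y n =
    trans (⊛-cancelˡ 2v≈1 (G x ⊕ G y) T H⊛[Gx⊕Gy]≋H⊛T n) (sym (twoNFall≋tTimes lam y n))
    where
    E H T : Series
    E = eλ lam 1#
    H = E ⊕ oneS
    T = tTimes (1# + 1#) (eλ lam y)
    eˣ≋E⊛eʸ : eλ lam x ≋ E ⊛ eλ lam y
    eˣ≋E⊛eʸ m = trans (fall-cong lam x≈1+y m) (eλ-+ lam 1# y m)
    H⊛[Gx⊕Gy]≋H⊛T : H ⊛ (G x ⊕ G y) ≋ H ⊛ T
    H⊛[Gx⊕Gy]≋H⊛T m = begin
      (H ⊛ (G x ⊕ G y)) m                         ≈⟨ ⊛-distribˡ-⊕ H (G x) (G y) m ⟩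
      (H ⊛ G x) m + (H ⊛ G y) m                   ≈⟨ +-cong (isG x m) (isG y m) ⟩
      (twoT ⊛ eλ lam x) m + (twoT ⊛ eλ lam y) m   ≈⟨ +-cong (twoT-⊛ _ m) (twoT-⊛ _ m) ⟩
      tTimes (1# + 1#) (eλ lam x) m + T m         ≈⟨ +-congʳ (tTimes-congʳ (1# + 1#) eˣ≋E⊛eʸ m) ⟩
      tTimes (1# + 1#) (E ⊛ eλ lam y) m + T m     ≈⟨ +-cong (⊛-tTimesʳ (1# + 1#) E (eλ lam y) m) (⊛-identityˡ T m) ⟨
      (E ⊛ T) m + (oneS ⊛ T) m                    ≈⟨ ⊛-distribʳ-⊕ T E oneS m ⟨
      (H ⊛ T) m                                   ∎

theorem3p5 : ∀ {c ℓ : Level} (R : CommutativeRing c ℓ) →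
    let open CommutativeRing R hiding (zero)
        open DegGenocchi R
    in ∃ (λ h → (1# + 1#) * h ≈ 1#) →
       (lam : Carrier) → ¬ (lam ≈ 0#) →
       (G : Carrier → Series) → IsDegGenocchi lam G →
       ∀ (x : Carrier) (n : ℕ) →
         G ((x + 1#) ⊖ lam) n ≈ twoNFall lam (x ⊖ lam) n ⊖ G (x ⊖ lam) n
theorem3p5 R (h , 2h≈1) lam _ G isG x n = begin
  G x′ n                    ≈⟨ //-rightDividesʳ (G y n) (G x′ n) ⟨
  (G x′ n + G y n) ⊖ G y n  ≈⟨ +-congʳ (genocchi-shift 2h≈1 lam G isG x′≈1+y n) ⟩
  twoNFall lam y n ⊖ G y n  ∎
  where
  open CommutativeRing R hiding (zero)
  open DegGenocchi R
  open DegGenocchiProperties R using (genocchi-shift)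
  open import Relation.Binary.Reasoning.Setoid setoid
  open import Algebra.Properties.Group +-group using (//-rightDividesʳ)
  open import Algebra.Properties.CommutativeSemigroup +-commutativeSemigroup using (x∙yz≈y∙xz)
  y x′ : Carrier
  y  = x ⊖ lam
  x′ = (x + 1#) ⊖ lam
  x′≈1+y : x′ ≈ 1# + y
  x′≈1+y = trans (+-assoc x 1# (- lam)) (x∙yz≈y∙xz x 1# (- lam))
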